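{- Let $\mathcal{L}$ be the family of all oriented paths on $\mathbb{N}$, i.e. all directed graphs $G$ with vertex set $\mathbb{N}$ such that for every $i\in\mathbb{N}$ exactly one of the ordered pairs $(i,i+1)$, $(i+1,i)$ is an edge of $G$, and $G$ has no other edges. Then $$\inf_{G\in\mathcal{L}} R(G)\;\geq\;\frac{\log 3}{3}\;>\;\frac12 .$$
   Context: For a directed graph $G$ with vertex set $\mathbb{N}$ and $n\in\mathbb{N}$, two permutations $\pi,\rho$ of $[n]=\{1,\dots,n\}$ are called $G$-different if there is $i\in[n]$ with $(\pi(i),\rho(i))\in E(G)$. A set of permutations is pairwise $G$-different if every two distinct members of it are $G$-different; note that since $G$ is directed, this requires for each pair $\pi\neq\rho$ both some $i$ with $(\pi(i),\rho(i))\in E(G)$ and some $j$ with $(\rho(j),\pi(j))\in E(G)$. $N(G,n)$ denotes the largest cardinality of a set of pairwise $G$-different permutations of $[n]$. The permutation capacity is $R(G)=\lim_{n\to\infty}\frac1n\log N(G,n)$ (this limit exists, possibly infinite, since $N(G,n)$ is supermultiplicative in $n$). All logarithms are to base 2. -}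

module Defs where

open import Data.Nat using (ℕ; zero; suc; _+_; _*_; _^_; _≤_; _<_)
open import Data.Fin using (Fin; toℕ)
open import Data.Fin.Permutation using (Permutation′; _⟨$⟩ʳ_)
open import Data.Product using (Σ; ∃; _×_; _,_)
open import Data.Sum using (_⊎_)
open import Relation.Binary.PropositionalEquality using (_≡_; _≢_)
open import Relation.Nullary using (¬_)

Digraph : Set₁
Digraph = ℕ → ℕ → Set

IsOrientedPath : Digraph → Set
IsOrientedPath E =
  (∀ i → (E i (suc i) ⊎ E (suc i) i) × ¬ (E i (suc i) × E (suc i) i))
  × (∀ a b → E a b → (b ≡ suc a ⊎ a ≡ suc b))

-- A permutation π of Fin n is read as the permutation of [n] = {1..n}
-- sending i+1 to toℕ (π i) + 1.
val : {n : ℕ} → Permutation′ n → Fin n → ℕ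
val π i = suc (toℕ (π ⟨$⟩ʳ i))

GDifferent : Digraph → {n : ℕ} → Permutation′ n → Permutation′ n → Set
GDifferent E π ρ = ∃ λ i → E (val π i) (val ρ i)

DistinctPerm : {n : ℕ} → Permutation′ n → Permutation′ n → Set
DistinctPerm π ρ = ∃ λ i → π ⟨$⟩ʳ i ≢ ρ ⟨$⟩ʳ i

-- A set of m distinct, pairwise G-different permutations of [n]
-- (indexed by Fin m). N(G,n) ≥ m iff such a family exists.
PairwiseGDifferentFamily : Digraph → (n m : ℕ) → Set
PairwiseGDifferentFamily E n m =
  Σ (Fin m → Permutation′ n) λ f →
    ∀ a b → a ≢ b → DistinctPerm (f a) (f b) × GDifferent E (f a) (f b)

{-# OPTIONS --safe #-}
-- Cut [n] into blocks of three consecutive vertices. On a block, the identity and the two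
-- transpositions of neighbouring values can be ranked 0, 1, 2 so that each is G-different from
-- every higher-ranked one; the ranking depends only on the orientation of the block's first edge.
-- Concatenating blocks along a word in {0,1,2}ᵗ, two distinct words of equal digit sum are each
-- somewhere smaller than the other, so their permutations are G-different in both directions.
-- Some digit sum is shared by at least 3ᵗ/(2t+1) words, hence N(G,3t) ≥ 3ᵗ/(2t+1), and products
-- of such families on translates of the path give rate (log 3)/3 up to an error that vanishes as
-- t grows.
module Submission where

open import Defs
open import Data.Nat using (ℕ; zero; suc; _+_; _*_; _^_; _≤_; _<_; z≤n; s≤s; NonZero)
open import Data.Nat.Properties
open import Algebra.Properties.CommutativeSemigroup +-commutativeSemigroup using () renaming (interchange to +-interchange)
open import Algebra.Properties.CommutativeSemigroup *-commutativeSemigroup using () renaming (interchange to *-interchange)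
open import Data.Empty using (⊥-elim)
open import Data.Nat.DivMod using (_/_; _%_; m≡m%n+[m/n]*n; m%n<n; m*n/n≡m; /-monoˡ-≤; m/n*n≤m)
open import Data.Nat.Tactic.RingSolver using (solve-∀)
open import Data.Fin as F using (Fin; toℕ; _↑ˡ_; _↑ʳ_)
open import Data.Fin.Properties using (toℕ-↑ˡ; toℕ-↑ʳ; splitAt-↑ˡ; splitAt-↑ʳ; +↔⊎; *↔×) renaming (_≟_ to _≟ᶠ_; <-cmp to <-cmpᶠ)
open import Data.Fin.Patterns using (0F; 1F; 2F)
open import Data.Fin.Permutation using (Permutation′; _⟨$⟩ʳ_; transpose; id)
open import Data.Vec using (Vec; []; _∷_; lookup; map; sum)
open import Data.Vec.Properties using (∷-injectiveʳ)
open import Data.Product using (Σ; ∃; _×_; _,_; proj₁; proj₂)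
open import Data.Product.Properties using (×-≡,≡→≡)
open import Data.Sum using (_⊎_; inj₁; inj₂; [_,_]′)
import Data.Sum as Sum
import Data.Product as Product
open import Data.Sum.Function.Propositional using (_⊎-↔_)
open import Function using (_∘_; _↔_; Inverse; Injection)
open import Function.Definitions using (Injective)
open import Function.Properties.Inverse using (↔-trans; ↔-sym; ↔-refl; ↔⇒↣)
open import Relation.Nullary using (¬_; yes; no)
open import Relation.Binary.PropositionalEquality
open import Relation.Binary.Definitions using (tri<; tri≈; tri>)

translate : ℕ → Digraph → Digraph
translate a E x y = E (a + x) (a + y)

translate-isOrientedPath : ∀ a {E} → IsOrientedPath E → IsOrientedPath (translate a E)
translate-isOrientedPath a {E} (orient , edges) = orient′ , edges′
  where
  orient′ : ∀ i → (translate a E i (suc i) ⊎ translate a E (suc i) i)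
                × ¬ (translate a E i (suc i) × translate a E (suc i) i)
  orient′ i rewrite +-suc a i = orient (a + i)
  cancel : ∀ x y → a + y ≡ suc (a + x) → y ≡ suc x
  cancel x y eq = +-cancelˡ-≡ a y (suc x) (trans eq (sym (+-suc a x)))
  edges′ : ∀ x y → translate a E x y → y ≡ suc x ⊎ x ≡ suc y
  edges′ x y e = Sum.map (cancel x y) (cancel y x) (edges (a + x) (a + y) e)

isOrientedPath⇒irreflexive : ∀ {E} → IsOrientedPath E → ∀ a → ¬ E a a
isOrientedPath⇒irreflexive (_ , edges) a e = [ 1+n≢n ∘ sym , 1+n≢n ∘ sym ]′ (edges a a e)

gDifferent⇒distinct : ∀ {E n} → IsOrientedPath E → (π ρ : Permutation′ n) →
                      GDifferent E π ρ → DistinctPerm π ρ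
gDifferent⇒distinct {E} op π ρ (i , e) =
  i , λ πi≡ρi → isOrientedPath⇒irreflexive op _ (subst (E (val π i) ∘ suc ∘ toℕ) (sym πi≡ρi) e)

pairwiseGDifferent⇒family : ∀ {E n m} → IsOrientedPath E → (f : Fin m → Permutation′ n) →
         (∀ a b → a ≢ b → GDifferent E (f a) (f b)) → PairwiseGDifferentFamily E n m
pairwiseGDifferent⇒family {E} op f gd = f , λ a b a≢b → gDifferent⇒distinct {E} op (f a) (f b) (gd a b a≢b) , gd a b a≢b

_⊕_ : ∀ {a b} → Permutation′ a → Permutation′ b → Permutation′ (a + b)
π ⊕ ρ = ↔-trans +↔⊎ (↔-trans (π ⊎-↔ ρ) (↔-sym +↔⊎))

val-⊕-↑ˡ : ∀ {a b} (π : Permutation′ a) (ρ : Permutation′ b) i → val (π ⊕ ρ) (i ↑ˡ b) ≡ val π i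
val-⊕-↑ˡ {a} {b} π ρ i rewrite splitAt-↑ˡ a i b = cong suc (toℕ-↑ˡ (π ⟨$⟩ʳ i) b)

val-⊕-↑ʳ : ∀ {a b} (π : Permutation′ a) (ρ : Permutation′ b) j → val (π ⊕ ρ) (a ↑ʳ j) ≡ a + val ρ j
val-⊕-↑ʳ {a} {b} π ρ j rewrite splitAt-↑ʳ a b j = trans (cong suc (toℕ-↑ʳ a (ρ ⟨$⟩ʳ j))) (sym (+-suc a _))

⊕-gDifferentˡ : ∀ {E a b} (π π′ : Permutation′ a) (ρ ρ′ : Permutation′ b) →
                GDifferent E π π′ → GDifferent E (π ⊕ ρ) (π′ ⊕ ρ′)
⊕-gDifferentˡ {E} {b = b} π π′ ρ ρ′ (i , e) =
  i ↑ˡ b , subst₂ E (sym (val-⊕-↑ˡ π ρ i)) (sym (val-⊕-↑ˡ π′ ρ′ i)) e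

⊕-gDifferentʳ : ∀ {E a b} (π π′ : Permutation′ a) (ρ ρ′ : Permutation′ b) →
                GDifferent (translate a E) ρ ρ′ → GDifferent E (π ⊕ ρ) (π′ ⊕ ρ′)
⊕-gDifferentʳ {E} {a} π π′ ρ ρ′ (j , e) =
  a ↑ʳ j , subst₂ E (sym (val-⊕-↑ʳ π ρ j)) (sym (val-⊕-↑ʳ π′ ρ′ j)) e

family-⊕ : ∀ {E a b m₁ m₂} → IsOrientedPath E →
           PairwiseGDifferentFamily E a m₁ → PairwiseGDifferentFamily (translate a E) b m₂ →
           PairwiseGDifferentFamily E (a + b) (m₁ * m₂)
family-⊕ {E} {m₁ = m₁} {m₂} op (f₁ , F₁) (f₂ , F₂) = pairwiseGDifferent⇒family op f gd
  where
  index : Fin (m₁ * m₂) → Fin m₁ × Fin m₂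
  index = Inverse.to *↔×
  index-injective : Injective _≡_ _≡_ index
  index-injective = Injection.injective (↔⇒↣ *↔×)
  f : Fin (m₁ * m₂) → Permutation′ _
  f k = f₁ (proj₁ (index k)) ⊕ f₂ (proj₂ (index k))
  gd : ∀ k k′ → k ≢ k′ → GDifferent E (f k) (f k′)
  gd k k′ k≢k′ with proj₁ (index k) ≟ᶠ proj₁ (index k′)
  ... | no i≢i′ = ⊕-gDifferentˡ {E} (f₁ _) (f₁ _) (f₂ _) (f₂ _) (proj₂ (F₁ _ _ i≢i′))
  ... | yes i≡i′ = ⊕-gDifferentʳ {E} (f₁ _) (f₁ _) (f₂ _) (f₂ _) (proj₂ (F₂ _ _ j≢j′))
    where
    j≢j′ : proj₂ (index k) ≢ proj₂ (index k′)
    j≢j′ j≡j′ = k≢k′ (index-injective (×-≡,≡→≡ (i≡i′ , j≡j′)))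

-- Families are built for all oriented paths at once because in a product the second
-- factor lives on a translate of the path.
UniformFamily : ℕ → ℕ → Set₁
UniformFamily n m = ∀ E → IsOrientedPath E → PairwiseGDifferentFamily E n m

uniform-* : ∀ {a b m₁ m₂} → UniformFamily a m₁ → UniformFamily b m₂ → UniformFamily (a + b) (m₁ * m₂)
uniform-* {a} F₁ F₂ E op = family-⊕ op (F₁ E op) (F₂ (translate a E) (translate-isOrientedPath a op))

uniform-singleton : ∀ n → UniformFamily n 1
uniform-singleton n E op = pairwiseGDifferent⇒family op (λ _ → id) λ { F.zero F.zero 0≢0 → ⊥-elim (0≢0 refl) }

uniform-pad : ∀ {n m} r → UniformFamily n m → UniformFamily (n + r) m
uniform-pad {n} {m} r F E op =
  subst (PairwiseGDifferentFamily E (n + r)) (*-identityʳ m) (uniform-* F (uniform-singleton r) E op)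

uniform-^ : ∀ {n m} → UniformFamily n m → ∀ g → UniformFamily (g * n) (m ^ g)
uniform-^ F zero = uniform-singleton 0
uniform-^ F (suc g) = uniform-* F (uniform-^ F g)

uniform-/ : ∀ {N m} .{{_ : NonZero N}} → UniformFamily N m → ∀ n → UniformFamily n (m ^ (n / N))
uniform-/ {N} {m} F n E op =
  subst (λ n′ → PairwiseGDifferentFamily E n′ (m ^ (n / N))) n≡ (uniform-pad (n % N) (uniform-^ F (n / N)) E op)
  where
  n≡ : n / N * N + n % N ≡ n
  n≡ = trans (+-comm _ (n % N)) (sym (m≡m%n+[m/n]*n n N))

RankedFamily : Digraph → ℕ → ℕ → Set
RankedFamily E k n = Σ (Fin k → Permutation′ n) λ σ → ∀ {s t} → s F.< t → GDifferent E (σ s) (σ t)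

UniformRanked : ℕ → ℕ → Set₁
UniformRanked k n = ∀ E → IsOrientedPath E → RankedFamily E k n

ranked₃ : ∀ {E n} (σ : Fin 3 → Permutation′ n) →
          GDifferent E (σ 0F) (σ 1F) → GDifferent E (σ 0F) (σ 2F) → GDifferent E (σ 1F) (σ 2F) →
          ∀ {s t} → s F.< t → GDifferent E (σ s) (σ t)
ranked₃ σ d₀₁ d₀₂ d₁₂ {0F} {1F} _ = d₀₁
ranked₃ σ d₀₁ d₀₂ d₁₂ {0F} {2F} _ = d₀₂
ranked₃ σ d₀₁ d₀₂ d₁₂ {1F} {2F} _ = d₁₂
ranked₃ σ d₀₁ d₀₂ d₁₂ {0F} {0F} ()
ranked₃ σ d₀₁ d₀₂ d₁₂ {1F} {0F} ()
ranked₃ σ d₀₁ d₀₂ d₁₂ {1F} {1F} (s≤s ())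
ranked₃ σ d₀₁ d₀₂ d₁₂ {2F} {0F} ()
ranked₃ σ d₀₁ d₀₂ d₁₂ {2F} {1F} (s≤s ())
ranked₃ σ d₀₁ d₀₂ d₁₂ {2F} {2F} (s≤s (s≤s ()))

-- In the 1-based labelling of val, τ₁₂ swaps the values 1, 2 and τ₂₃ swaps 2, 3.
τ₁₂ τ₂₃ : Permutation′ 3
τ₁₂ = transpose 0F 1F
τ₂₃ = transpose 1F 2F

id-τ₂₃-gDifferent : ∀ {E} → E 2 3 ⊎ E 3 2 → GDifferent E id τ₂₃
id-τ₂₃-gDifferent (inj₁ e₂₃) = 1F , e₂₃
id-τ₂₃-gDifferent (inj₂ e₃₂) = 2F , e₃₂

-- id and τ₂₃ are G-different in both directions, so only the edge {1,2} decides where τ₁₂ is ranked.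
rankedBlock : ∀ {E} → E 1 2 ⊎ E 2 1 → E 2 3 ⊎ E 3 2 → RankedFamily E 3 3
rankedBlock {E} (inj₁ e₁₂) o₂₃ = σ , ranked₃ {E} σ (id-τ₂₃-gDifferent {E} o₂₃) (0F , e₁₂) (0F , e₁₂)
  where
  σ : Fin 3 → Permutation′ 3
  σ = λ { 0F → id ; 1F → τ₂₃ ; 2F → τ₁₂ }
rankedBlock {E} (inj₂ e₂₁) o₂₃ = σ , ranked₃ {E} σ (1F , e₂₁) (id-τ₂₃-gDifferent {E} o₂₃) (0F , e₂₁)
  where
  σ : Fin 3 → Permutation′ 3
  σ = λ { 0F → id ; 1F → τ₁₂ ; 2F → τ₂₃ }

uniformRanked-block : UniformRanked 3 3
uniformRanked-block E (orient , _) = rankedBlock {E} (proj₁ (orient 1)) (proj₁ (orient 2))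

weight : ∀ {k t} → Vec (Fin k) t → ℕ
weight u = sum (map toℕ u)

weight≤⇒digit< : ∀ {k t} (u v : Vec (Fin k) t) → weight u ≤ weight v → u ≢ v →
                 ∃ λ i → lookup u i F.< lookup v i
weight≤⇒digit< [] [] _ []≢[] = ⊥-elim ([]≢[] refl)
weight≤⇒digit< (x ∷ u) (y ∷ v) w≤ x∷u≢y∷v with <-cmpᶠ x y
... | tri< x<y _ _ = F.zero , x<y
... | tri≈ _ refl _ =
  Product.map F.suc (λ lt → lt) (weight≤⇒digit< u v (+-cancelˡ-≤ (toℕ x) _ _ w≤) (x∷u≢y∷v ∘ cong (x ∷_)))
... | tri> _ _ y<x =
  Product.map F.suc (λ lt → lt) (weight≤⇒digit< u v (<⇒≤ wu<wv) (<⇒≢ wu<wv ∘ cong weight))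
  where
  wu<wv : weight u < weight v
  wu<wv = +-cancelˡ-< (toℕ y) _ _ (<-≤-trans (+-monoˡ-< (weight u) y<x) w≤)

module Words {k b} (R : UniformRanked k b) where

  word : ∀ {t} E → IsOrientedPath E → Vec (Fin k) t → Permutation′ (t * b)
  word E op [] = id
  word E op (d ∷ u) = proj₁ (R E op) d ⊕ word (translate b E) (translate-isOrientedPath b op) u

  word-gDifferent : ∀ {t} E (op : IsOrientedPath E) (u v : Vec (Fin k) t) →
                    (∃ λ i → lookup u i F.< lookup v i) → GDifferent E (word E op u) (word E op v)
  word-gDifferent E op (x ∷ u) (y ∷ v) (F.zero , x<y) =
    ⊕-gDifferentˡ {E} (proj₁ (R E op) x) (proj₁ (R E op) y) (word _ op′ u) (word _ op′ v) (proj₂ (R E op) x<y)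
    where op′ = translate-isOrientedPath b op
  word-gDifferent E op (x ∷ u) (y ∷ v) (F.suc i , lt) =
    ⊕-gDifferentʳ {E} (proj₁ (R E op) x) (proj₁ (R E op) y) (word _ op′ u) (word _ op′ v)
      (word-gDifferent _ op′ u v (i , lt))
    where op′ = translate-isOrientedPath b op

  uniform-words : ∀ {t m s} (w : Fin m → Vec (Fin k) t) → Injective _≡_ _≡_ w →
                  (∀ i → weight (w i) ≡ s) → UniformFamily (t * b) m
  uniform-words w w-injective w-weight E op = pairwiseGDifferent⇒family op (word E op ∘ w) λ i j i≢j →
    word-gDifferent E op (w i) (w j)
      (weight≤⇒digit< (w i) (w j) (≤-reflexive (trans (w-weight i) (sym (w-weight j)))) (i≢j ∘ w-injective))

shift : (ℕ → ℕ) → ℕ → ℕ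
shift f zero = 0
shift f (suc s) = f s

-- count t s is the number of words in {0,1,2}ᵗ of weight s, split by first digit.
count : ℕ → ℕ → ℕ
count zero zero = 1
count zero (suc s) = 0
count (suc t) s = count t s + (shift (count t) s + shift (shift (count t)) s)

split₃ : ∀ {a b c} → Fin (a + (b + c)) ↔ (Fin a ⊎ (Fin b ⊎ Fin c))
split₃ = ↔-trans +↔⊎ (↔-refl ⊎-↔ +↔⊎)

FirstDigit : ℕ → ℕ → Set
FirstDigit t s = Fin (count t s) ⊎ (Fin (shift (count t) s) ⊎ Fin (shift (shift (count t)) s))

enumerate : ∀ t s → Fin (count t s) → Vec (Fin 3) t
prepend : ∀ t s → FirstDigit t s → Vec (Fin 3) (suc t)
enumerate zero zero _ = []
enumerate (suc t) s k = prepend t s (Inverse.to split₃ k)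
prepend t s (inj₁ k) = 0F ∷ enumerate t s k
prepend t (suc s) (inj₂ (inj₁ k)) = 1F ∷ enumerate t s k
prepend t (suc (suc s)) (inj₂ (inj₂ k)) = 2F ∷ enumerate t s k

enumerate-weight : ∀ t s k → weight (enumerate t s k) ≡ s
prepend-weight : ∀ t s d → weight (prepend t s d) ≡ s
enumerate-weight zero zero _ = refl
enumerate-weight (suc t) s k = prepend-weight t s (Inverse.to split₃ k)
prepend-weight t s (inj₁ k) = enumerate-weight t s k
prepend-weight t (suc s) (inj₂ (inj₁ k)) = cong suc (enumerate-weight t s k)
prepend-weight t (suc (suc s)) (inj₂ (inj₂ k)) = cong (suc ∘ suc) (enumerate-weight t s k)

enumerate-injective : ∀ t s → Injective _≡_ _≡_ (enumerate t s)
prepend-injective : ∀ t s → Injective _≡_ _≡_ (prepend t s)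
enumerate-injective zero zero {0F} {0F} _ = refl
enumerate-injective (suc t) s = Injection.injective (↔⇒↣ split₃) ∘ prepend-injective t s
prepend-injective t s {inj₁ k} {inj₁ k′} eq = cong inj₁ (enumerate-injective t s (∷-injectiveʳ eq))
prepend-injective t (suc s) {inj₂ (inj₁ k)} {inj₂ (inj₁ k′)} eq =
  cong (inj₂ ∘ inj₁) (enumerate-injective t s (∷-injectiveʳ eq))
prepend-injective t (suc (suc s)) {inj₂ (inj₂ k)} {inj₂ (inj₂ k′)} eq =
  cong (inj₂ ∘ inj₂) (enumerate-injective t s (∷-injectiveʳ eq))
prepend-injective t (suc s) {inj₁ _} {inj₂ (inj₁ _)} ()
prepend-injective t (suc (suc s)) {inj₁ _} {inj₂ (inj₂ _)} ()
prepend-injective t (suc s) {inj₂ (inj₁ _)} {inj₁ _} ()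
prepend-injective t (suc (suc s)) {inj₂ (inj₁ _)} {inj₂ (inj₂ _)} ()
prepend-injective t (suc (suc s)) {inj₂ (inj₂ _)} {inj₁ _} ()
prepend-injective t (suc (suc s)) {inj₂ (inj₂ _)} {inj₂ (inj₁ _)} ()

sumTo : (ℕ → ℕ) → ℕ → ℕ
sumTo f zero = 0
sumTo f (suc B) = sumTo f B + f B

sumTo-+ : ∀ f g B → sumTo (λ s → f s + g s) B ≡ sumTo f B + sumTo g B
sumTo-+ f g zero = refl
sumTo-+ f g (suc B) = trans (cong (_+ (f B + g B)) (sumTo-+ f g B)) (+-interchange (sumTo f B) (sumTo g B) (f B) (g B))

sumTo-shift : ∀ f B → sumTo (shift f) (suc B) ≡ sumTo f B
sumTo-shift f zero = refl
sumTo-shift f (suc B) = cong (_+ f B) (sumTo-shift f B)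

sumTo-count-zero : ∀ B → sumTo (count 0) (suc B) ≡ 1
sumTo-count-zero zero = refl
sumTo-count-zero (suc B) = trans (+-identityʳ _) (sumTo-count-zero B)

sumTo-count : ∀ t B → 2 * t < B → sumTo (count t) B ≡ 3 ^ t
sumTo-count zero (suc B) _ = sumTo-count-zero B
sumTo-count (suc t) (suc zero) (s≤s ())
sumTo-count (suc t) (suc (suc B)) 2t+2<B+2 = begin
  sumTo (count (suc t)) (2 + B)
    ≡⟨ trans (sumTo-+ (count t) _ (2 + B)) (cong (sumTo (count t) (2 + B) +_) (sumTo-+ _ _ (2 + B))) ⟩
  sumTo (count t) (2 + B) + (sumTo (shift (count t)) (2 + B) + sumTo (shift (shift (count t))) (2 + B))
    ≡⟨ cong₂ (λ x y → sumTo (count t) (2 + B) + (x + y))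
             (sumTo-shift (count t) (suc B))
             (trans (sumTo-shift (shift (count t)) (suc B)) (sumTo-shift (count t) B)) ⟩
  sumTo (count t) (2 + B) + (sumTo (count t) (1 + B) + sumTo (count t) B)
    ≡⟨ cong₂ _+_ (sumTo-count t (2 + B) (m<n⇒m<1+n (m<n⇒m<1+n 2t<B)))
                 (cong₂ _+_ (sumTo-count t (1 + B) (m<n⇒m<1+n 2t<B)) (sumTo-count t B 2t<B)) ⟩
  3 ^ t + (3 ^ t + 3 ^ t)
    ≡⟨ cong (λ x → 3 ^ t + (3 ^ t + x)) (sym (+-identityʳ (3 ^ t))) ⟩
  3 ^ suc t ∎
  where
  open ≡-Reasoning
  2t<B : 2 * t < B
  2t<B = ≤-pred (≤-pred (subst (_< 2 + B) (*-suc 2 t) 2t+2<B+2))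

sumTo-≤-max : ∀ f B → ∃ λ s → sumTo f B ≤ B * f s
sumTo-≤-max f zero = 0 , z≤n
sumTo-≤-max f (suc B) = extend (sumTo-≤-max f B)
  where
  step : ∀ {x} → sumTo f B ≤ B * x → f B ≤ x → sumTo f (suc B) ≤ suc B * x
  step {x} S≤ fB≤ = ≤-trans (+-mono-≤ S≤ fB≤) (≤-reflexive (+-comm (B * x) x))
  extend : (∃ λ s → sumTo f B ≤ B * f s) → ∃ λ s → sumTo f (suc B) ≤ suc B * f s
  extend (s , S≤) = [ (λ fs≤fB → B , step (≤-trans S≤ (*-monoʳ-≤ B fs≤fB)) ≤-refl)
                    , (λ fB≤fs → s , step S≤ fB≤fs) ]′ (≤-total (f s) (f B))

heaviest-weight : ∀ t → ∃ λ s → 3 ^ t ≤ suc (2 * t) * count t s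
heaviest-weight t with sumTo-≤-max (count t) (suc (2 * t))
... | s , S≤ = s , subst (_≤ suc (2 * t) * count t s) (sumTo-count t (suc (2 * t)) ≤-refl) S≤

^-distribʳ-* : ∀ a b n → (a * b) ^ n ≡ a ^ n * b ^ n
^-distribʳ-* a b zero = refl
^-distribʳ-* a b (suc n) = trans (cong (a * b *_) (^-distribʳ-* a b n)) (*-interchange a b (a ^ n) (b ^ n))

suc-≤-2^ : ∀ n → suc n ≤ 2 ^ n
suc-≤-2^ zero = ≤-refl
suc-≤-2^ (suc n) = +-mono-≤ (m^n>0 2 n) (≤-trans (suc-≤-2^ n) (≤-reflexive (sym (+-identityʳ (2 ^ n)))))

cube-bound : ∀ {t k c} → 3 ^ t ≤ 2 ^ k * c → 3 ^ (t * 3) ≤ c ^ 3 * 2 ^ (k * 3)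
cube-bound {t} {k} {c} 3^t≤ = begin
  3 ^ (t * 3)           ≡⟨ ^-*-assoc 3 t 3 ⟨
  (3 ^ t) ^ 3           ≤⟨ ^-monoˡ-≤ 3 3^t≤ ⟩
  (2 ^ k * c) ^ 3       ≡⟨ ^-distribʳ-* (2 ^ k) c 3 ⟩
  (2 ^ k) ^ 3 * c ^ 3   ≡⟨ *-comm ((2 ^ k) ^ 3) (c ^ 3) ⟩
  c ^ 3 * (2 ^ k) ^ 3   ≡⟨ cong (c ^ 3 *_) (^-*-assoc 2 k 3) ⟩
  c ^ 3 * 2 ^ (k * 3)   ∎
  where open ≤-Reasoning

power-bound : ∀ {N c K} → 3 ^ N ≤ c ^ 3 * 2 ^ K → ∀ g → 3 ^ (g * N) ≤ (c ^ g) ^ 3 * 2 ^ (g * K)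
power-bound 3^N≤ zero = ≤-refl
power-bound {N} {c} {K} 3^N≤ (suc g) = begin
  3 ^ (N + g * N)                                   ≡⟨ ^-distribˡ-+-* 3 N (g * N) ⟩
  3 ^ N * 3 ^ (g * N)                               ≤⟨ *-mono-≤ 3^N≤ (power-bound 3^N≤ g) ⟩
  c ^ 3 * 2 ^ K * ((c ^ g) ^ 3 * 2 ^ (g * K))       ≡⟨ *-interchange (c ^ 3) (2 ^ K) _ _ ⟩
  c ^ 3 * (c ^ g) ^ 3 * (2 ^ K * 2 ^ (g * K))       ≡⟨ cong₂ _*_ (^-distribʳ-* c (c ^ g) 3) (^-distribˡ-+-* 2 K (g * K)) ⟨
  (c * c ^ g) ^ 3 * 2 ^ (K + g * K)                 ∎
  where open ≤-Reasoning

-- The remainder n % N is absorbed by the factor 2 ^ (2 * N) ≥ 3 ^ N.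
power-bound-/ : ∀ {N c K} .{{_ : NonZero N}} → 3 ^ N ≤ c ^ 3 * 2 ^ K →
                ∀ n → 3 ^ n ≤ (c ^ (n / N)) ^ 3 * 2 ^ (n / N * K + 2 * N)
power-bound-/ {N} {c} {K} 3^N≤ n = begin
  3 ^ n                                              ≡⟨ cong (3 ^_) n≡ ⟩
  3 ^ (g * N + r)                                    ≡⟨ ^-distribˡ-+-* 3 (g * N) r ⟩
  3 ^ (g * N) * 3 ^ r                                ≤⟨ *-mono-≤ (power-bound 3^N≤ g) 3^r≤ ⟩
  (c ^ g) ^ 3 * 2 ^ (g * K) * 2 ^ (2 * N)            ≡⟨ *-assoc ((c ^ g) ^ 3) _ _ ⟩
  (c ^ g) ^ 3 * (2 ^ (g * K) * 2 ^ (2 * N))          ≡⟨ cong ((c ^ g) ^ 3 *_) (^-distribˡ-+-* 2 (g * K) (2 * N)) ⟨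
  (c ^ g) ^ 3 * 2 ^ (g * K + 2 * N)                  ∎
  where
  open ≤-Reasoning
  g r : ℕ
  g = n / N
  r = n % N
  n≡ : n ≡ g * N + r
  n≡ = trans (m≡m%n+[m/n]*n n N) (+-comm r (g * N))
  3^r≤ : 3 ^ r ≤ 2 ^ (2 * N)
  3^r≤ = begin
    3 ^ r         ≤⟨ ^-monoʳ-≤ 3 (<⇒≤ (m%n<n n N)) ⟩
    3 ^ N         ≤⟨ ^-monoˡ-≤ N (n≤1+n 3) ⟩
    (2 ^ 2) ^ N   ≡⟨ ^-*-assoc 2 2 N ⟩
    2 ^ (2 * N)   ∎

root-bound : ∀ {n M L Q X} → 3 ^ n ≤ M ^ 3 * 2 ^ L → L * Q ≤ X → 3 ^ (n * Q) ≤ M ^ (3 * Q) * 2 ^ X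
root-bound {n} {M} {L} {Q} {X} 3^n≤ LQ≤X = begin
  3 ^ (n * Q)                  ≡⟨ ^-*-assoc 3 n Q ⟨
  (3 ^ n) ^ Q                  ≤⟨ ^-monoˡ-≤ Q 3^n≤ ⟩
  (M ^ 3 * 2 ^ L) ^ Q          ≡⟨ ^-distribʳ-* (M ^ 3) (2 ^ L) Q ⟩
  (M ^ 3) ^ Q * (2 ^ L) ^ Q    ≡⟨ cong₂ _*_ (^-*-assoc M 3 Q) (^-*-assoc 2 L Q) ⟩
  M ^ (3 * Q) * 2 ^ (L * Q)    ≤⟨ *-monoʳ-≤ (M ^ (3 * Q)) (^-monoʳ-≤ 2 LQ≤X) ⟩
  M ^ (3 * Q) * 2 ^ X          ∎
  where open ≤-Reasoning

-- Blocks of t = 4^Q triples lose the factor 2t + 1 ≤ 2^(2 + 2Q), i.e. at most 1/Q per coordinate.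
module Construction (Q : ℕ) where

  t N K : ℕ
  t = 2 ^ (Q + Q)
  N = t * 3
  K = (2 + (Q + Q)) * 3

  instance
    N-nonZero : NonZero N
    N-nonZero = m*n≢0 t 3 {{m^n≢0 2 (Q + Q)}}

  s c : ℕ
  s = proj₁ (heaviest-weight t)
  c = count t s

  uniform-blocks : UniformFamily N c
  uniform-blocks =
    Words.uniform-words uniformRanked-block (enumerate t s) (enumerate-injective t s) (enumerate-weight t s)

  block-bound : 3 ^ N ≤ c ^ 3 * 2 ^ K
  block-bound = cube-bound {t} {2 + (Q + Q)} (≤-trans (proj₂ (heaviest-weight t)) (*-monoˡ-≤ c 2t+1≤))
    where
    open ≤-Reasoning
    2t+1≤ : suc (2 * t) ≤ 2 ^ (2 + (Q + Q))
    2t+1≤ = begin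
      suc (2 * t)       ≤⟨ +-monoˡ-≤ (2 * t) (≤-trans (m^n>0 2 (Q + Q)) (m≤m+n t (t + 0))) ⟩
      2 * t + 2 * t     ≡⟨ cong (2 * t +_) (+-identityʳ (2 * t)) ⟨
      2 * (2 * t)       ∎

  exponent-bound : ∀ n → 6 * Q * N ≤ n → (n / N * K + 2 * N) * Q ≤ 3 * n
  exponent-bound n n₀≤n = begin
    (g * K + 2 * N) * Q                        ≡⟨ expand g Q t ⟩
    g * (6 * (Q * suc Q)) + 6 * Q * t          ≤⟨ +-mono-≤ (*-monoʳ-≤ g (*-monoʳ-≤ 6 Q[Q+1]≤t)) (*-monoˡ-≤ t 6Q≤g) ⟩
    g * (6 * t) + g * t                        ≤⟨ +-monoʳ-≤ (g * (6 * t)) (m≤n*m (g * t) 3) ⟩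
    g * (6 * t) + 3 * (g * t)                  ≡⟨ collect g t ⟩
    3 * (g * N)                                ≤⟨ *-monoʳ-≤ 3 (m/n*n≤m n N) ⟩
    3 * n                                      ∎
    where
    open ≤-Reasoning
    g : ℕ
    g = n / N
    6Q≤g : 6 * Q ≤ g
    6Q≤g = subst (_≤ g) (m*n/n≡m (6 * Q) N) (/-monoˡ-≤ N n₀≤n)
    Q[Q+1]≤t : Q * suc Q ≤ t
    Q[Q+1]≤t = begin
      Q * suc Q           ≤⟨ *-monoˡ-≤ (suc Q) (n≤1+n Q) ⟩
      suc Q * suc Q       ≤⟨ *-mono-≤ (suc-≤-2^ Q) (suc-≤-2^ Q) ⟩
      2 ^ Q * 2 ^ Q       ≡⟨ ^-distribˡ-+-* 2 Q Q ⟨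
      t                   ∎
    expand : ∀ g Q t → (g * ((2 + (Q + Q)) * 3) + 2 * (t * 3)) * Q ≡ g * (6 * (Q * suc Q)) + 6 * Q * t
    expand = solve-∀
    collect : ∀ g t → g * (6 * t) + 3 * (g * t) ≡ 3 * (g * (t * 3))
    collect = solve-∀

theorem1 : ((E : Digraph) → IsOrientedPath E →
               (p q : ℕ) → ∃ λ n₀ → (n : ℕ) → n₀ ≤ n →
               ∃ λ m → PairwiseGDifferentFamily E n m
                 × 3 ^ (n * suc q) ≤ m ^ (3 * suc q) * 2 ^ (3 * n * suc p))
             × (2 ^ 3 < 3 ^ 2)
theorem1 = (λ E op p q → let open Construction (suc q) in
              6 * suc q * N , λ n n₀≤n →
                c ^ (n / N) ,
                uniform-/ uniform-blocks n E op ,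
                root-bound {n} {c ^ (n / N)} {n / N * K + 2 * N} (power-bound-/ {N} {c} {K} block-bound n)
                           (≤-trans (exponent-bound n n₀≤n) (m≤m*n (3 * n) (suc p))))
         , ≤-refl
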